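{- Let $\mathsf{P},\mathsf{Q}\in\mathbb{P}_{\mathrm{fin}}$ and let $\tau:P\to Q$ be a winning ultrapositional strategy for player II in the game $G_{\mathbb{P}}(\mathsf{P},\mathsf{Q})$. Then for all $p\in P$: (1) $\mathrm{Str}_{\mathrm{incr}}(p)\leq\mathrm{Str}_{\mathrm{incr}}(\tau(p))$, and (2) $\mathrm{Str}_{\mathrm{decr}}(p)\leq\mathrm{Str}_{\mathrm{decr}}(\tau(p))$.
   Context: A 2-colored poset is $\mathsf{P}=(P,\leq_p,\mathrm{col}_p)$, $\mathrm{col}_p:P\to\{0,1\}$. $\cdot\rightarrowtail_c\cdot$ denotes existence of an injective order- and color-preserving map sending immediate predecessors to immediate predecessors. A countable poset is a shrub if (1) there is no injective order-preserving map from $(\omega,\leq)$ into it; (2) every element has finitely many elements below it; (3) it has a minimal element $\bot$; (4) every subset with an upper bound has a least upper bound. $\mathbb{P}_{\mathrm{lay}}$ is the class of countable 2-colored posets whose underlying poset is a shrub, with $\mathrm{col}(\bot)=0$, every maximal element of color $1$, and none of $\vee^0_1$ ($a<b$, $a<c$, $b\perp c$, colors of $a,b,c$ being $1,0,0$), $\wedge^1_0$ ($a<c$, $b<c$, $a\perp b$, $\mathrm{col}(c)=1$, $\mathrm{col}(a)=\mathrm{col}(b)=0$), $\mid^1_1$ ($a<b$ both color 1) satisfying $\cdot\rightarrowtail_c\mathsf{P}$. $\mathbb{P}_{\mathrm{fin}}$ is the class of $\mathsf{P}\in\mathbb{P}_{\mathrm{lay}}$ such that every $p\neq\bot$ has finitely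 many $p'$ with $p\leq_p p'$. Strengths in $\mathsf{P}\in\mathbb{P}_{\mathrm{fin}}$: an alternating sequence from $p$ is a sequence $(s_n)_{n<k}$ with $s_0=p$ and $\mathrm{col}_p(s_n)=\mathrm{col}_p(p)$ iff $n$ is even. $\mathrm{Str}_{\mathrm{incr}}(p)$ is the largest length $k\in\omega$ of a strictly $\leq_p$-increasing alternating sequence from $p$ if such a largest length exists, and $\omega$ otherwise. $\mathrm{Str}_{\mathrm{decr}}(p)\in\omega$ is the largest length of a strictly $\leq_p$-decreasing alternating sequence from $p$. The game $G_{\mathbb{P}}(\mathsf{P},\mathsf{Q})$: in round $n\in\omega$, I picks $p_n\in P$, then II picks $q_n\in Q$; I must play eventually constantly. II wins iff for all $n,m$, $p_n\leq_p p_m\Rightarrow q_n\leq_q q_m$, and $\mathrm{col}_p(p_n)=\mathrm{col}_q(q_n)$ for all $n$. An ultrapositional strategy for II is a function $\tau:P\to Q$ (II plays $q_n=\tau(p_n)$); it is winning if every run following it is won by II. -}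

module Defs where

open import Data.Nat as ℕ using (ℕ; zero; suc; _%_)
open import Data.Fin as Fin using (Fin; toℕ)
open import Data.Product using (Σ; Σ-syntax; ∃; _×_; _,_)
open import Data.List using (List)
open import Data.List.Membership.Propositional using (_∈_)
open import Data.Empty using (⊥)
open import Relation.Nullary using (¬_)
open import Relation.Binary.PropositionalEquality using (_≡_; _≢_)
open import Relation.Binary.Structures using (IsPartialOrder)
open import Function.Definitions using (Injective)
open import Function.Bundles using (_⇔_)

Colour : Set
Colour = Fin 2

c0 c1 : Colour
c0 = Fin.zero
c1 = Fin.suc Fin.zero

-- Raw 2-coloured relational structures (used for the patterns)

record ColRel : Set₁ where
  field
    Carrier : Set
    _≤_     : Carrier → Carrier → Set
    col     : Carrier → Colour

  _<_ : Carrier → Carrier → Set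
  x < y = (x ≤ y) × (x ≢ y)

  ImmPred : Carrier → Carrier → Set
  ImmPred x y = (x < y) × (∀ z → x < z → z < y → ⊥)

record ColPoset : Set₁ where
  field
    rel       : ColRel
  open ColRel rel public
  field
    isPartialOrder : IsPartialOrder _≡_ _≤_

_↣c_ : ColRel → ColRel → Set
A ↣c B = Σ[ f ∈ (A.Carrier → B.Carrier) ]
           Injective _≡_ _≡_ f
         × (∀ x y → x A.≤ y → f x B.≤ f y)
         × (∀ x → B.col (f x) ≡ A.col x)
         × (∀ x y → A.ImmPred x y → B.ImmPred (f x) (f y))
  where
    module A = ColRel A
    module B = ColRel B

-- ∨⁰₁ : a < b, a < c, b ⊥ c ; col a = 1, col b = col c = 0
-- elements: 0 = a, 1 = b, 2 = c
data ∨≤ : Fin 3 → Fin 3 → Set where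
  ∨-refl : ∀ {x} → ∨≤ x x
  ∨-ab   : ∨≤ Fin.zero (Fin.suc Fin.zero)
  ∨-ac   : ∨≤ Fin.zero (Fin.suc (Fin.suc Fin.zero))

∨col : Fin 3 → Colour
∨col Fin.zero = c1
∨col (Fin.suc _) = c0

Pat-∨⁰₁ : ColRel
Pat-∨⁰₁ = record { Carrier = Fin 3 ; _≤_ = ∨≤ ; col = ∨col }

-- ∧¹₀ : a < c, b < c, a ⊥ b ; col c = 1, col a = col b = 0
-- elements: 0 = a, 1 = b, 2 = c
data ∧≤ : Fin 3 → Fin 3 → Set where
  ∧-refl : ∀ {x} → ∧≤ x x
  ∧-ac   : ∧≤ Fin.zero (Fin.suc (Fin.suc Fin.zero))
  ∧-bc   : ∧≤ (Fin.suc Fin.zero) (Fin.suc (Fin.suc Fin.zero))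

∧col : Fin 3 → Colour
∧col Fin.zero = c0
∧col (Fin.suc Fin.zero) = c0
∧col (Fin.suc (Fin.suc _)) = c1

Pat-∧¹₀ : ColRel
Pat-∧¹₀ = record { Carrier = Fin 3 ; _≤_ = ∧≤ ; col = ∧col }

-- |¹₁ : a < b, both of colour 1 ; elements 0 = a, 1 = b
data ∣≤ : Fin 2 → Fin 2 → Set where
  ∣-refl : ∀ {x} → ∣≤ x x
  ∣-ab   : ∣≤ Fin.zero (Fin.suc Fin.zero)

Pat-∣¹₁ : ColRel
Pat-∣¹₁ = record { Carrier = Fin 2 ; _≤_ = ∣≤ ; col = λ _ → c1 }

module _ (P : ColPoset) where
  open ColPoset P

  Countable : Set
  Countable = Σ[ f ∈ (Carrier → ℕ) ] Injective _≡_ _≡_ f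

  FiniteSet : (Carrier → Set) → Set
  FiniteSet S = Σ[ xs ∈ List Carrier ] (∀ x → S x → x ∈ xs)

  UpperBound : (Carrier → Set) → Carrier → Set
  UpperBound S u = ∀ x → S x → x ≤ u

  IsLUB : (Carrier → Set) → Carrier → Set
  IsLUB S u = UpperBound S u × (∀ v → UpperBound S v → u ≤ v)

  Minimal : Carrier → Set
  Minimal b = ∀ x → x ≤ b → x ≡ b

  Maximal : Carrier → Set
  Maximal m = ∀ y → m ≤ y → y ≡ m

  IsShrub : Carrier → Set₁
  IsShrub bot =
      Countable
    × ¬ (Σ[ f ∈ (ℕ → Carrier) ] Injective _≡_ _≡_ f
                               × (∀ m n → m ℕ.≤ n → f m ≤ f n))
    × (∀ p → FiniteSet (λ x → x ≤ p))
    × Minimal bot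
    × (∀ (S : Carrier → Set) → Σ[ u ∈ Carrier ] UpperBound S u
         → Σ[ l ∈ Carrier ] IsLUB S l)

  InPlay : Carrier → Set₁
  InPlay bot =
      IsShrub bot
    × col bot ≡ c0
    × (∀ m → Maximal m → col m ≡ c1)
    × ¬ (Pat-∨⁰₁ ↣c rel)
    × ¬ (Pat-∧¹₀ ↣c rel)
    × ¬ (Pat-∣¹₁ ↣c rel)

  InPfin : Carrier → Set₁
  InPfin bot = InPlay bot × (∀ p → p ≢ bot → FiniteSet (λ p' → p ≤ p'))

data ℕω : Set where
  fin : ℕ → ℕω
  ω   : ℕω

data _≤ω_ : ℕω → ℕω → Set where
  fin≤fin : ∀ {m n} → m ℕ.≤ n → fin m ≤ω fin n
  _≤ω-ω   : ∀ x → x ≤ω ω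

module _ (P : ColPoset) where
  open ColPoset P

  Alternating : Carrier → (k : ℕ) → (Fin k → Carrier) → Set
  Alternating p k s =
      (∀ i → toℕ i ≡ 0 → s i ≡ p)
    × (∀ i → (col (s i) ≡ col p) ⇔ (toℕ i % 2 ≡ 0))

  IncrAltSeq : Carrier → ℕ → Set
  IncrAltSeq p k = Σ[ s ∈ (Fin k → Carrier) ]
      Alternating p k s × (∀ i j → i Fin.< j → s i < s j)

  DecrAltSeq : Carrier → ℕ → Set
  DecrAltSeq p k = Σ[ s ∈ (Fin k → Carrier) ]
      Alternating p k s × (∀ i j → i Fin.< j → s j < s i)

  IsLargest : (ℕ → Set) → ℕ → Set
  IsLargest L k = L k × (∀ k' → L k' → k' ℕ.≤ k)

  StrIncr : Carrier → ℕω → Set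
  StrIncr p (fin k) = IsLargest (IncrAltSeq p) k
  StrIncr p ω       = ¬ (Σ[ k ∈ ℕ ] IsLargest (IncrAltSeq p) k)

  StrDecr : Carrier → ℕ → Set
  StrDecr p k = IsLargest (DecrAltSeq p) k

EventuallyConstant : {A : Set} → (ℕ → A) → Set
EventuallyConstant f = Σ[ N ∈ ℕ ] (∀ n → N ℕ.≤ n → f n ≡ f N)

module _ (P Q : ColPoset) where
  private
    module P = ColPoset P
    module Q = ColPoset Q

  IIWins : (ℕ → P.Carrier) → (ℕ → Q.Carrier) → Set
  IIWins ps qs = (∀ n m → ps n P.≤ ps m → qs n Q.≤ qs m)
               × (∀ n → P.col (ps n) ≡ Q.col (qs n))

  WinningUltrapositional : (P.Carrier → Q.Carrier) → Set
  WinningUltrapositional τ =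
    ∀ (ps : ℕ → P.Carrier) → EventuallyConstant ps → IIWins ps (λ n → τ (ps n))

module Submission where

open import Defs
open import Data.Nat using (ℕ; zero; suc; _+_; _%_; _≤_; _<_; s≤s)
open import Data.Nat.Properties using (≤-trans; ≤-reflexive; <⇒≱; ≮⇒≥; +-suc; +-monoʳ-≤; m≤m+n)
open import Data.Fin as Fin using (Fin; toℕ; fromℕ<)
open import Data.Fin.Properties using (toℕ-fromℕ<; toℕ<n; ≤∧≢⇒<)
open import Data.Product using (_×_; _,_; proj₁; proj₂; Σ-syntax)
open import Data.Empty using (⊥)
open import Relation.Nullary using (¬_; yes; no)
open import Relation.Binary.PropositionalEquality
open import Relation.Binary.Structures using (IsPartialOrder)
open import Function using (_∘_)
open import Function.Bundles using (_⇔_; mk⇔; Equivalence)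
import Function.Properties.Equivalence as ⇔

-- Proof idea: playing the two-move runs  a, b, b, …  shows that τ is monotone and
-- colour-preserving, so it maps alternating chains of P to alternating chains of Q
-- of the same length. Such a chain stays strict: if τ identified two of its members,
-- monotonicity would also identify the one right after the first, whose colour differs.

parity-flips : ∀ n → ¬ ((n % 2 ≡ 0) ⇔ (suc n % 2 ≡ 0))
parity-flips zero    even⇔odd with Equivalence.to even⇔odd refl
... | ()
parity-flips (suc n) even⇔odd = parity-flips n (⇔.sym even⇔odd)

successor-index : ∀ {k} {i j : Fin k} → i Fin.< j
                → Σ[ m ∈ Fin k ] toℕ m ≡ suc (toℕ i) × i Fin.< m × m Fin.≤ j
successor-index {j = j} i<j =
  fromℕ< (≤-trans (s≤s i<j) (toℕ<n j)) , toℕ-fromℕ< _ ,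
  ≤-reflexive (sym (toℕ-fromℕ< _)) , ≤-trans (≤-reflexive (toℕ-fromℕ< _)) i<j

<-monotone⇒≤-monotone : ∀ {X : Set} {k} (R : X → X → Set) → (∀ {x} → R x x)
                      → (g : Fin k → X) → (∀ i j → i Fin.< j → R (g i) (g j))
                      → ∀ {i j} → i Fin.≤ j → R (g i) (g j)
<-monotone⇒≤-monotone R R-refl g mono {i} {j} i≤j with i Fin.≟ j
... | yes refl = R-refl
... | no  i≢j  = mono i j (≤∧≢⇒< i≤j i≢j)

module _ (A : ColPoset) where
  open ColPoset A using (col)

  alternating-adjacent-colours-differ : ∀ {p k s} → Alternating A p k s
                                      → ∀ {i m} → toℕ m ≡ suc (toℕ i) → col (s i) ≢ col (s m)
  alternating-adjacent-colours-differ {p} {s = s} (_ , parity) {i} {m} m≡1+i same =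
    parity-flips (toℕ i) (subst (λ n → (toℕ i % 2 ≡ 0) ⇔ (n % 2 ≡ 0)) m≡1+i
      (⇔.trans (⇔.sym (parity i)) (⇔.trans same-as-p (parity m))))
    where
    same-as-p : (col (s i) ≡ col p) ⇔ (col (s m) ≡ col p)
    same-as-p = mk⇔ (trans (sym same)) (trans same)

  empty-incrAltSeq : ∀ {p} → IncrAltSeq A p 0
  empty-incrAltSeq = (λ ()) , ((λ ()) , (λ ())) , λ ()

  -- Constructively a bounded family need not have a largest member, but it cannot
  -- lack one: induct on the gap between the bound and a member.
  no-largest⇒unbounded : ∀ {L : ℕ → Set} {k l} → ¬ (Σ[ n ∈ ℕ ] IsLargest A L n)
                       → L k → ¬ (∀ n → L n → n ≤ l)
  no-largest⇒unbounded {L} {k} {l} no-largest Lk bound =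
    beyond (suc l) k (s≤s (m≤m+n l k)) Lk
    where
    beyond : ∀ d n → l < d + n → L n → ⊥
    beyond zero    n l<n Ln = <⇒≱ l<n (bound n Ln)
    beyond (suc d) n l<1+d+n Ln = no-largest (n , Ln , λ n' Ln' → ≮⇒≥ λ n<n' →
      beyond d n' (≤-trans l<1+d+n (subst (_≤ d + n') (+-suc d n) (+-monoʳ-≤ d n<n'))) Ln')

module _ {A B : ColPoset} (f : ColPoset.Carrier A → ColPoset.Carrier B)
         (f-mono : ∀ {a b} → ColPoset._≤_ A a b → ColPoset._≤_ B (f a) (f b))
         (f-col : ∀ a → ColPoset.col B (f a) ≡ ColPoset.col A a) where
  private
    module A = ColPoset A
    module B = ColPoset B
    module A≤ = IsPartialOrder A.isPartialOrder
    module B≤ = IsPartialOrder B.isPartialOrder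

  image-constant-between : ∀ {a b c} → a A.≤ b → b A.≤ c → f a ≡ f c → f a ≡ f b × f b ≡ f c
  image-constant-between {a} {b} a≤b b≤c fa≡fc = fa≡fb , trans (sym fa≡fb) fa≡fc
    where
    fa≡fb : f a ≡ f b
    fa≡fb = B≤.antisym (f-mono a≤b) (subst (f b B.≤_) (sym fa≡fc) (f-mono b≤c))

  same-image⇒same-colour : ∀ {a b} → f a ≡ f b → A.col a ≡ A.col b
  same-image⇒same-colour {a} {b} fa≡fb = trans (sym (f-col a)) (trans (cong B.col fa≡fb) (f-col b))

  map-alternating : ∀ {p k s} → Alternating A p k s → Alternating B (f p) k (f ∘ s)
  map-alternating {p} {s = s} (starts-at-p , parity) =
    (λ i i≡0 → cong f (starts-at-p i i≡0)) , image-parity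
    where
    image-parity : ∀ i → (B.col (f (s i)) ≡ B.col (f p)) ⇔ (toℕ i % 2 ≡ 0)
    image-parity i rewrite f-col (s i) | f-col p = parity i

  map-incrAltSeq : ∀ {p k} → IncrAltSeq A p k → IncrAltSeq B (f p) k
  map-incrAltSeq (s , alt , incr) =
    f ∘ s , map-alternating alt , λ i j i<j → f-mono (proj₁ (incr i j i<j)) , images-differ i<j
    where
    images-differ : ∀ {i j} → i Fin.< j → f (s i) ≢ f (s j)
    images-differ i<j fsi≡fsj with successor-index i<j
    ... | m , m≡1+i , i<m , m≤j =
      alternating-adjacent-colours-differ A alt m≡1+i (same-image⇒same-colour
        (proj₁ (image-constant-between (proj₁ (incr _ m i<m))
          (<-monotone⇒≤-monotone A._≤_ A≤.refl s (λ i j → proj₁ ∘ incr i j) m≤j) fsi≡fsj)))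

  map-decrAltSeq : ∀ {p k} → DecrAltSeq A p k → DecrAltSeq B (f p) k
  map-decrAltSeq (s , alt , decr) =
    f ∘ s , map-alternating alt , λ i j i<j → f-mono (proj₁ (decr i j i<j)) , images-differ i<j
    where
    images-differ : ∀ {i j} → i Fin.< j → f (s j) ≢ f (s i)
    images-differ i<j fsj≡fsi with successor-index i<j
    ... | m , m≡1+i , i<m , m≤j =
      alternating-adjacent-colours-differ A alt m≡1+i (sym (same-image⇒same-colour
        (proj₂ (image-constant-between
          (<-monotone⇒≤-monotone (λ x y → y A.≤ x) A≤.refl s (λ i j → proj₁ ∘ decr i j) m≤j)
          (proj₁ (decr _ m i<m)) fsj≡fsi))))

module _ (A B : ColPoset) {p : ColPoset.Carrier A} {q : ColPoset.Carrier B} where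

  StrIncr-mono : (∀ k → IncrAltSeq A p k → IncrAltSeq B q k)
               → ∀ s t → StrIncr A p s → StrIncr B q t → s ≤ω t
  StrIncr-mono embed s       ω       _ _ = s ≤ω-ω
  StrIncr-mono embed (fin k) (fin l) (seq-k , _) (_ , largest-l) = fin≤fin (largest-l k (embed k seq-k))
  StrIncr-mono embed ω       (fin l) no-largest (_ , largest-l) with
    no-largest⇒unbounded A no-largest (empty-incrAltSeq A) (λ k → largest-l k ∘ embed k)
  ... | ()

  StrDecr-mono : (∀ k → DecrAltSeq A p k → DecrAltSeq B q k)
               → ∀ k l → StrDecr A p k → StrDecr B q l → k ≤ l
  StrDecr-mono embed k l (seq-k , _) (_ , largest-l) = largest-l k (embed k seq-k)

module _ (P Q : ColPoset) (τ : ColPoset.Carrier P → ColPoset.Carrier Q)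
         (winning : WinningUltrapositional P Q τ) where
  private
    module P = ColPoset P
    module Q = ColPoset Q

    two-move-run : P.Carrier → P.Carrier → ℕ → P.Carrier
    two-move-run a b zero    = a
    two-move-run a b (suc _) = b

    two-move-run-eventually-constant : ∀ a b → EventuallyConstant (two-move-run a b)
    two-move-run-eventually-constant a b = 1 , λ { zero () ; (suc n) _ → refl }

    wins-two-move-run : ∀ a b → IIWins P Q (two-move-run a b) (τ ∘ two-move-run a b)
    wins-two-move-run a b = winning (two-move-run a b) (two-move-run-eventually-constant a b)

  winning⇒monotone : ∀ {a b} → a P.≤ b → τ a Q.≤ τ b
  winning⇒monotone {a} {b} = proj₁ (wins-two-move-run a b) 0 1

  winning⇒colour-preserving : ∀ a → Q.col (τ a) ≡ P.col a
  winning⇒colour-preserving a = sym (proj₂ (wins-two-move-run a a) 0)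

lemma35 : (P Q : ColPoset) (⊥P : ColPoset.Carrier P) (⊥Q : ColPoset.Carrier Q)
          → InPfin P ⊥P → InPfin Q ⊥Q
          → (τ : ColPoset.Carrier P → ColPoset.Carrier Q)
          → WinningUltrapositional P Q τ
          → ∀ p
          → (∀ s t → StrIncr P p s → StrIncr Q (τ p) t → s ≤ω t)
          × (∀ k l → StrDecr P p k → StrDecr Q (τ p) l → k ≤ l)
lemma35 P Q _ _ _ _ τ winning p =
  StrIncr-mono P Q (λ _ → map-incrAltSeq {P} {Q} τ mono colour) ,
  StrDecr-mono P Q (λ _ → map-decrAltSeq {P} {Q} τ mono colour)
  where
  mono : ∀ {a b} → ColPoset._≤_ P a b → ColPoset._≤_ Q (τ a) (τ b)
  mono = winning⇒monotone P Q τ winning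

  colour : ∀ a → ColPoset.col Q (τ a) ≡ ColPoset.col P a
  colour = winning⇒colour-preserving P Q τ winning
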